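{- Let $x$ and $y$ be two strings of length $m$ over the same alphabet $\Sigma$. Let $s$ be a prefix of $y$ and $u$ a prefix of $x$ with $|s| = |u|$ and $\mathrm{utd}(s,u) < \infty$. Suppose there are strings $z, w, w'$ with $|z| > 0$ and $|w'| > |w| > 0$ such that (i) $swz$ is a prefix of $y$ and $uzw$ is a prefix of $x$, and (ii) $sw'z$ is a prefix of $y$ and $uzw'$ is a prefix of $x$. Set $i = |swz|$ and $j = |sw'z|$. Then $\mathrm{utd}(x[i+1..j], y[i+1..j]) < \infty$.
   Context: Strings are indexed from $1$; $x[a..b]$ denotes the factor of $x$ from position $a$ to position $b$. An unbalanced translocation of adjacent factors transforms a factor of the form $ab$ into $ba$, with $a,b$ nonempty strings (possibly of different lengths). For strings $p,q$, $\mathrm{utd}(p,q)$ is the minimum number of non-overlapping unbalanced translocations of adjacent factors transforming $p$ into $q$ (i.e. the least $t$ such that $p = p_1\cdots p_r$, $q=q_1\cdots q_r$ with each pair either equal or of the form $p_\ell = ab$, $q_\ell = ba$ with $a,b$ nonempty, exactly $t$ pairs of the second kind), and $\infty$ if no such transformation exists; in particular $\mathrm{utd}(p,p)=0$. -}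

module Defs where

open import Data.List using (List; []; _∷_; _++_; length; take; drop)
open import Data.Nat using (ℕ; zero; suc)
open import Data.Product using (∃)
open import Relation.Binary.PropositionalEquality using (_≡_)

-- Strings over an alphabet Σ are lists; x[a..b] (1-indexed, inclusive) is
-- take (b ∸ a + 1) (drop (a ∸ 1) x).
factor : {Σ : Set} → List Σ → ℕ → ℕ → List Σ
factor x a b = take (suc b Data.Nat.∸ a) (drop (a Data.Nat.∸ 1) x)

data NonEmpty {Σ : Set} : List Σ → Set where
  nonEmpty : (c : Σ) (cs : List Σ) → NonEmpty (c ∷ cs)

-- Translocations p q t : p = p1⋯pr, q = q1⋯qr, each pair equal or
-- (ab, ba) with a, b nonempty, exactly t pairs of the second kind.
data Translocations {Σ : Set} : List Σ → List Σ → ℕ → Set where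
  done  : Translocations [] [] 0
  same  : ∀ {p q t} (c : List Σ) →
          Translocations p q t → Translocations (c ++ p) (c ++ q) t
  swap  : ∀ {p q t} (a b : List Σ) → NonEmpty a → NonEmpty b →
          Translocations p q t →
          Translocations ((a ++ b) ++ p) ((b ++ a) ++ q) (suc t)

UtdFinite : {Σ : Set} → List Σ → List Σ → Set
UtdFinite p q = ∃ λ t → Translocations p q t

_IsPrefixOf_ : {Σ : Set} → List Σ → List Σ → Set
s IsPrefixOf y = ∃ λ r → s ++ r ≡ y

-- After cancelling s, both wz and w'z are prefixes of the same string, so
-- w' = wv and vz = zt, where t is the text of y between positions i and j.
-- Conjugate words are rotations of each other (v = pq, t = qp), while x
-- reads exactly v between the same positions because |uzw| = |swz|; and
-- pq becomes qp by a single translocation.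
module Submission where

open import Defs
open import Data.List using (List; []; _∷_; _++_; length; take; drop)
open import Data.List.Properties
  using (++-assoc; ++-identityʳ; ++-identityʳ-unique; ++-cancelˡ; ++-monoid;
         ∷-injective; length-++; length-++-comm; length-++-≤ʳ)
open import Data.Nat using (ℕ; suc; _+_; _∸_; _≤_; _<_; s≤s)
open import Data.Nat.Properties
  using (≤-total; ≤-pred; <⇒≤; n<1+n; m≤n+m; +-comm; m+n∸m≡n; m+n∸n≡m; module ≤-Reasoning)
open import Data.Product using (∃; ∃₂; _×_; _,_)
open import Data.Sum using (inj₁; inj₂)
open import Relation.Binary.PropositionalEquality
open import Tactic.MonoidSolver using (solve)

module _ {A : Set} where

  drop-length-++ : ∀ (xs ys : List A) → drop (length xs) (xs ++ ys) ≡ ys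
  drop-length-++ []       ys = refl
  drop-length-++ (x ∷ xs) ys = drop-length-++ xs ys

  take-length-++ : ∀ (xs ys : List A) → take (length xs) (xs ++ ys) ≡ xs
  take-length-++ []       ys = refl
  take-length-++ (x ∷ xs) ys = cong (x ∷_) (take-length-++ xs ys)

  length-++-rotate : ∀ (s u a b : List A) → length s ≡ length u →
                     length (s ++ a ++ b) ≡ length (u ++ b ++ a)
  length-++-rotate s u a b |s|≡|u| = begin
    length (s ++ a ++ b)         ≡⟨ length-++ s ⟩
    length s + length (a ++ b)   ≡⟨ cong₂ _+_ |s|≡|u| (length-++-comm a b) ⟩
    length u + length (b ++ a)   ≡⟨ length-++ u ⟨
    length (u ++ b ++ a)         ∎
    where open ≡-Reasoning

  ++-equidivisible : ∀ (a b c d : List A) → a ++ b ≡ c ++ d → length a ≤ length c →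
                     ∃ λ e → c ≡ a ++ e × b ≡ e ++ d
  ++-equidivisible []      b c       d ab≡cd _ = c , refl , ab≡cd
  ++-equidivisible (x ∷ a) b (y ∷ c) d ab≡cd (s≤s |a|≤|c|) with ∷-injective ab≡cd
  ... | refl , ab≡cd′ with ++-equidivisible a b c d ab≡cd′ |a|≤|c|
  ...   | e , c≡ae , b≡ed = e , cong (x ∷_) c≡ae , b≡ed

  conjugate⇒rotation : ∀ (v z t : List A) → v ++ z ≡ z ++ t →
                       ∃₂ λ p q → v ≡ p ++ q × t ≡ q ++ p
  conjugate⇒rotation v z t = go (suc (length z)) v z t (n<1+n (length z))
    where
    go : ∀ n (v z t : List A) → length z < n → v ++ z ≡ z ++ t →
         ∃₂ λ p q → v ≡ p ++ q × t ≡ q ++ p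
    go (suc n) []      z t _ z≡zt = [] , [] , refl , ++-identityʳ-unique z z≡zt
    go (suc n) (c ∷ v) z t |z|<1+n vz≡zt with ≤-total (length z) (length (c ∷ v))
    ... | inj₁ |z|≤|v| with ++-equidivisible z t (c ∷ v) z (sym vz≡zt) |z|≤|v|
    ...   | e , v≡ze , t≡ez = z , e , v≡ze , t≡ez
    go (suc n) (c ∷ v) z t |z|<1+n vz≡zt | inj₂ |v|≤|z|
      with ++-equidivisible (c ∷ v) z z t vz≡zt |v|≤|z|
    ...   | e , z≡ve , z≡et = go n (c ∷ v) e t |e|<n (trans (sym z≡ve) z≡et)
      where
      open ≤-Reasoning
      |e|<n : length e < n
      |e|<n = begin-strict
        length e                ≤⟨ m≤n+m (length e) (length v) ⟩
        length v + length e     ≡⟨ length-++ v ⟨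
        length (v ++ e)         <⟨ n<1+n _ ⟩
        length ((c ∷ v) ++ e)   ≡⟨ cong length z≡ve ⟨
        length z                ≤⟨ ≤-pred |z|<1+n ⟩
        n                       ∎

  overlap⇒conjugate : ∀ (w w′ z r r′ : List A) → (w ++ z) ++ r ≡ (w′ ++ z) ++ r′ →
                      length w ≤ length w′ →
                      ∃₂ λ v t → w′ ≡ w ++ v × r ≡ t ++ r′ × v ++ z ≡ z ++ t
  overlap⇒conjugate w w′ z r r′ wzr≡w′zr′ |w|≤|w′|
    with ++-equidivisible w (z ++ r) w′ (z ++ r′) wzr≡w′zr′′ |w|≤|w′|
    where
    wzr≡w′zr′′ : w ++ z ++ r ≡ w′ ++ z ++ r′
    wzr≡w′zr′′ = trans (sym (++-assoc w z r)) (trans wzr≡w′zr′ (++-assoc w′ z r′))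
  ... | v , w′≡wv , zr≡vzr′
    with ++-equidivisible z r (v ++ z) r′ (trans zr≡vzr′ (sym (++-assoc v z r′)))
                          (length-++-≤ʳ z {v})
  ... | t , vz≡zt , r≡tr′ = v , t , w′≡wv , r≡tr′ , vz≡zt

  common-prefix : ∀ {y : List A} (s a b r r′ : List A) →
                  (s ++ a) ++ r ≡ y → (s ++ b) ++ r′ ≡ y → a ++ r ≡ b ++ r′
  common-prefix s a b r r′ sar≡y sbr′≡y = ++-cancelˡ s (a ++ r) (b ++ r′)
    (trans (sym (++-assoc s a r)) (trans sar≡y (trans (sym sbr′≡y) (++-assoc s b r′))))

  factor-after : ∀ {x : List A} {i j} (a b r : List A) → x ≡ a ++ b ++ r →
                 length a ≡ i → length (a ++ b) ≡ j → factor x (i + 1) j ≡ b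
  factor-after a b r refl refl refl = begin
    take (suc (length (a ++ b)) ∸ (length a + 1)) (drop (length a + 1 ∸ 1) (a ++ b ++ r))
      ≡⟨ cong₂ (λ n k → take n (drop k (a ++ b ++ r))) count (m+n∸n≡m (length a) 1) ⟩
    take (length b) (drop (length a) (a ++ b ++ r))
      ≡⟨ cong (take (length b)) (drop-length-++ a (b ++ r)) ⟩
    take (length b) (b ++ r)
      ≡⟨ take-length-++ b r ⟩
    b ∎
    where
    open ≡-Reasoning
    count : suc (length (a ++ b)) ∸ (length a + 1) ≡ length b
    count = begin
      suc (length (a ++ b)) ∸ (length a + 1)
        ≡⟨ cong₂ (λ m n → suc m ∸ n) (length-++ a) (+-comm (length a) 1) ⟩
      suc (length a + length b) ∸ suc (length a)
        ≡⟨ m+n∸m≡n (length a) (length b) ⟩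
      length b ∎

  Translocations-refl : ∀ (p : List A) → Translocations p p 0
  Translocations-refl p = subst (λ r → Translocations r r 0) (++-identityʳ p) (same p done)

  rotation-utdFinite : ∀ (p q : List A) → UtdFinite (p ++ q) (q ++ p)
  rotation-utdFinite []      q       =
    0 , subst (λ r → Translocations q r 0) (sym (++-identityʳ q)) (Translocations-refl q)
  rotation-utdFinite (a ∷ p) []      =
    0 , subst (λ r → Translocations r (a ∷ p) 0) (sym (++-identityʳ (a ∷ p)))
              (Translocations-refl (a ∷ p))
  rotation-utdFinite (a ∷ p) (b ∷ q) =
    1 , subst₂ (λ r r′ → Translocations r r′ 1) (++-identityʳ _) (++-identityʳ _)
               (swap (a ∷ p) (b ∷ q) (nonEmpty a p) (nonEmpty b q) done)

lemma4 : {Σ : Set} (m : ℕ) (x y s u z w w' : List Σ) →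
         length x ≡ m → length y ≡ m →
         s IsPrefixOf y → u IsPrefixOf x → length s ≡ length u →
         UtdFinite s u →
         0 < length z → 0 < length w → length w < length w' →
         (s ++ w ++ z) IsPrefixOf y → (u ++ z ++ w) IsPrefixOf x →
         (s ++ w' ++ z) IsPrefixOf y → (u ++ z ++ w') IsPrefixOf x →
         UtdFinite (factor x (length (s ++ w ++ z) + 1) (length (s ++ w' ++ z)))
                   (factor y (length (s ++ w ++ z) + 1) (length (s ++ w' ++ z)))
lemma4 {Σ} m x y s u z w w' _ _ _ _ |s|≡|u| _ _ _ |w|<|w'|
       (r₁ , swzr₁≡y) _ (r₂ , sw'zr₂≡y) (r₃ , uzw'r₃≡x)
  with overlap⇒conjugate w w' z r₁ r₂ (common-prefix s (w ++ z) (w' ++ z) r₁ r₂ swzr₁≡y sw'zr₂≡y)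
                         (<⇒≤ |w|<|w'|)
... | v , t , refl , refl , vz≡zt with conjugate⇒rotation v z t vz≡zt
... | p , q , refl , refl =
  subst₂ UtdFinite (sym factor-x) (sym factor-y) (rotation-utdFinite p q)
  where
  open ≡-Reasoning
  M = ++-monoid Σ
  factor-x : factor x (length (s ++ w ++ z) + 1) (length (s ++ w' ++ z)) ≡ p ++ q
  factor-x = factor-after (u ++ z ++ w) (p ++ q) r₃
    (begin
      x                                 ≡⟨ uzw'r₃≡x ⟨
      (u ++ z ++ w ++ p ++ q) ++ r₃     ≡⟨ solve M ⟩
      (u ++ z ++ w) ++ (p ++ q) ++ r₃   ∎)
    (length-++-rotate u s z w (sym |s|≡|u|))
    (begin
      length ((u ++ z ++ w) ++ p ++ q)  ≡⟨ cong length (++-assoc u (z ++ w) (p ++ q)) ⟩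
      length (u ++ (z ++ w) ++ p ++ q)  ≡⟨ cong (λ c → length (u ++ c)) (++-assoc z w (p ++ q)) ⟩
      length (u ++ z ++ w ++ p ++ q)    ≡⟨ length-++-rotate s u (w ++ p ++ q) z |s|≡|u| ⟨
      length (s ++ w' ++ z)             ∎)
  factor-y : factor y (length (s ++ w ++ z) + 1) (length (s ++ w' ++ z)) ≡ q ++ p
  factor-y = factor-after (s ++ w ++ z) (q ++ p) r₂ (sym swzr₁≡y) refl
    (cong length (begin
      (s ++ w ++ z) ++ q ++ p           ≡⟨ solve M ⟩
      s ++ w ++ z ++ q ++ p             ≡⟨ cong (λ c → s ++ w ++ c) vz≡zt ⟨
      s ++ w ++ (p ++ q) ++ z           ≡⟨ solve M ⟩
      s ++ w' ++ z                      ∎))
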